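{- Let $k,n$ be positive integers, $m=(n-1)k+1$, and let $N\in\mathcal{N}$. Let $\Sigma(N)\subseteq\Pi^{(k)}_m$ be the set of all elements $\bigvee^k_{x\in X}x$ for $X\subseteq N$ (the unique minimal upper bound of $X$ in $\Pi^{(k)}_m$, which exists for every $X\subseteq N$; for $X=\emptyset$ it is the minimal element), with the order induced from $\Pi^{(k)}_m$. Then $\Sigma(N)$ is a lattice, and $N$ is a building set for $\Sigma(N)$.
   Context: $\Pi_m$ is the lattice of set partitions of $\{1,\dots,m\}$ ordered by refinement, $\mathrm{rk}(x)=m-(\text{number of blocks of }x)$, and $\Pi^{(k)}_m\subseteq\Pi_m$ is the subposet of partitions with all block sizes congruent to $1$ modulo $k$. $\mathcal{I}$ is the set of partitions with exactly one block of size larger than $1$, and $\mathcal{G}=\{x\in\mathcal{I}\mid\mathrm{rk}(x)\equiv0\pmod k\}$. For $x_1,\dots,x_\ell\in\Pi^{(k)}_m$ say that their join exists uniquely if $\{x_1,\dots,x_\ell\}$ has exactly one minimal upper bound in $\Pi^{(k)}_m$, denoted $x_1\vee^k\dots\vee^k x_\ell$. $\mathcal{N}$ is the family of all nonempty subsets $N\subseteq\mathcal{G}$ not containing the maximal partition such that for every set $\{x_1,\dots,x_\ell\}\subseteq N$ of $\ell\ge2$ pairwise incomparable elements, $x_1\vee^k\dots\vee^k x_\ell$ exists uniquely and is not in $\mathcal{G}$. Building set: if $\mathcal{L}$ is a poset with a unique minimal element $\hat0$, a subset $\mathcal{B}\subseteq\mathcal{L}\setminus\{\hat0\}$ is a building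 set if for every $x\in\mathcal{L}\setminus\{\hat0\}$ there is a poset isomorphism $\varphi_x:\prod_{z\in\max\mathcal{B}_{\le x}}[\hat0,z]\to[\hat0,x]$ with $\varphi_x(\hat0,\dots,\hat0,z,\hat0,\dots,\hat0)=z$ for each $z\in\max\mathcal{B}_{\le x}$ (here $\max\mathcal{B}_{\le x}$ is the set of maximal elements of $\{b\in\mathcal{B}\mid b\le x\}$ and $[\hat0,z]$ denotes an interval). -}

module Defs where

open import Data.Nat using (ℕ; zero; suc; _+_; _*_; _∸_; _≤_; _≤ᵇ_; _<ᵇ_)
open import Data.Nat.Divisibility using (_∣_)
open import Data.Bool using (Bool; true; false; not; _∨_; _∧_; if_then_else_)
open import Data.Fin using (Fin; toℕ)
import Data.Fin as F
open import Data.List using (List; length; lookup)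
open import Data.List.Relation.Unary.All using (All)
open import Data.List.Relation.Unary.Any using (Any)
open import Data.List.Relation.Unary.AllPairs using (AllPairs)
open import Data.Product using (Σ; ∃; _×_; proj₁)
open import Relation.Binary.PropositionalEquality using (_≡_)
open import Relation.Nullary using (¬_)

countF : ∀ {m} → (Fin m → Bool) → ℕ
countF {zero}  f = 0
countF {suc m} f = (if f F.zero then 1 else 0) + countF (λ i → f (F.suc i))

allF : ∀ {m} → (Fin m → Bool) → Bool
allF {zero}  f = true
allF {suc m} f = f F.zero ∧ allF (λ i → f (F.suc i))

-- Set partitions of {1,…,m} (= Fin m), as equivalence relations
-- ("i and j lie in the same block").

record Partition (m : ℕ) : Set where
  field
    R      : Fin m → Fin m → Bool
    R-refl  : ∀ i → R i i ≡ true
    R-sym   : ∀ i j → R i j ≡ true → R j i ≡ true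
    R-trans : ∀ i j l → R i j ≡ true → R j l ≡ true → R i l ≡ true
open Partition public

_⊑_ : ∀ {m} → Partition m → Partition m → Set
x ⊑ y = ∀ i j → R x i j ≡ true → R y i j ≡ true

blockSize : ∀ {m} → Partition m → Fin m → ℕ
blockSize x i = countF (R x i)

-- i is the least element of its block (each block has exactly one leader)
isLeader : ∀ {m} → Partition m → Fin m → Bool
isLeader x i = allF (λ j → not (R x i j) ∨ (toℕ i ≤ᵇ toℕ j))

numBlocks : ∀ {m} → Partition m → ℕ
numBlocks x = countF (isLeader x)

rk : ∀ {m} → Partition m → ℕ
rk {m} x = m ∸ numBlocks x

-- all block sizes ≡ 1 (mod k)   (block sizes are ≥ 1)
AllBlocks1modk : ∀ {m} → ℕ → Partition m → Set
AllBlocks1modk k x = ∀ i → k ∣ (blockSize x i ∸ 1)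

PiK : ℕ → ℕ → Set
PiK k m = Σ (Partition m) (AllBlocks1modk k)

_≤ₖ_ : ∀ {k m} → PiK k m → PiK k m → Set
x ≤ₖ y = proj₁ x ⊑ proj₁ y

_≈ₖ_ : ∀ {k m} → PiK k m → PiK k m → Set
x ≈ₖ y = (x ≤ₖ y) × (y ≤ₖ x)

InI : ∀ {m} → Partition m → Set
InI x = countF (λ i → isLeader x i ∧ (1 <ᵇ blockSize x i)) ≡ 1

InG : ∀ {m} → ℕ → Partition m → Set
InG k x = InI x × (k ∣ rk x)

IsTop : ∀ {m} → Partition m → Set
IsTop x = ∀ i j → R x i j ≡ true

IsBot : ∀ {m} → Partition m → Set
IsBot x = ∀ i j → R x i j ≡ true → i ≡ j

UpperBound : ∀ {k m} → List (PiK k m) → PiK k m → Set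
UpperBound S u = All (_≤ₖ u) S

MinUpperBound : ∀ {k m} → List (PiK k m) → PiK k m → Set
MinUpperBound S u =
  UpperBound S u × (∀ v → UpperBound S v → v ≤ₖ u → u ≤ₖ v)

IsUniqueJoin : ∀ {k m} → List (PiK k m) → PiK k m → Set
IsUniqueJoin S u = MinUpperBound S u × (∀ v → MinUpperBound S v → v ≈ₖ u)

Incomparable : ∀ {k m} → PiK k m → PiK k m → Set
Incomparable x y = ¬ (x ≤ₖ y) × ¬ (y ≤ₖ x)

record InNFamily (k m : ℕ) (N : PiK k m → Set) : Set where
  field
    respects  : ∀ x y → x ≈ₖ y → N x → N y
    nonempty  : ∃ N
    subsetG   : ∀ x → N x → InG k (proj₁ x)
    noTop     : ∀ x → N x → ¬ IsTop (proj₁ x)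
    joins     : ∀ (S : List (PiK k m)) → All N S → AllPairs Incomparable S →
                2 ≤ length S →
                ∃ λ u → IsUniqueJoin S u × ¬ InG k (proj₁ u)

InSigma : ∀ {k m} → (PiK k m → Set) → PiK k m → Set
InSigma N y = ∃ λ (X : List _) → All N X × MinUpperBound X y

IsLUBIn : ∀ {k m} → (PiK k m → Set) → PiK k m → PiK k m → PiK k m → Set
IsLUBIn P a b z = P z × a ≤ₖ z × b ≤ₖ z × (∀ w → P w → a ≤ₖ w → b ≤ₖ w → z ≤ₖ w)

IsGLBIn : ∀ {k m} → (PiK k m → Set) → PiK k m → PiK k m → PiK k m → Set
IsGLBIn P a b z = P z × z ≤ₖ a × z ≤ₖ b × (∀ w → P w → w ≤ₖ a → w ≤ₖ b → w ≤ₖ z)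

IsLatticeSub : ∀ {k m} → (PiK k m → Set) → Set
IsLatticeSub P = ∀ a b → P a → P b → (∃ (IsLUBIn P a b)) × (∃ (IsGLBIn P a b))

-- Building sets, for the sub-poset L ⊆ Π^{(k)}_m (whose minimal element
-- is the discrete partition) and B ⊆ L.

MaxBelow : ∀ {k m} → (PiK k m → Set) → PiK k m → PiK k m → Set
MaxBelow B x z = B z × z ≤ₖ x × (∀ b → B b → b ≤ₖ x → z ≤ₖ b → b ≤ₖ z)

Interval : ∀ {k m} → (PiK k m → Set) → PiK k m → Set
Interval L x = Σ _ (λ y → L y × y ≤ₖ x)

Product : ∀ {k m} → (PiK k m → Set) → List (PiK k m) → Set
Product L Z = (i : Fin (length Z)) → Interval L (lookup Z i)

leI : ∀ {k m} (L : PiK k m → Set) x → Interval L x → Interval L x → Set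
leI L x a b = proj₁ a ≤ₖ proj₁ b

eqI : ∀ {k m} (L : PiK k m → Set) x → Interval L x → Interval L x → Set
eqI L x a b = proj₁ a ≈ₖ proj₁ b

leP : ∀ {k m} (L : PiK k m → Set) Z → Product L Z → Product L Z → Set
leP L Z s t = ∀ i → leI L (lookup Z i) (s i) (t i)

eqP : ∀ {k m} (L : PiK k m → Set) Z → Product L Z → Product L Z → Set
eqP L Z s t = ∀ i → eqI L (lookup Z i) (s i) (t i)

-- a poset isomorphism φ : ∏_{z∈Z}[0̂,z] → [0̂,x] with φ(0̂,…,z,…,0̂) = z
IsBuildingIso : ∀ {k m} (L : PiK k m → Set) (Z : List (PiK k m)) x →
                (Product L Z → Interval L x) → Set
IsBuildingIso L Z x φ =
  ∃ λ (ψ : Interval L x → Product L Z) →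
    (∀ s t → leP L Z s t → leI L x (φ s) (φ t)) ×
    (∀ a b → leI L x a b → leP L Z (ψ a) (ψ b)) ×
    (∀ t → eqP L Z (ψ (φ t)) t) ×
    (∀ a → eqI L x (φ (ψ a)) a) ×
    (∀ (t : Product L Z) (i : Fin (length Z)) →
       proj₁ (t i) ≈ₖ lookup Z i →
       (∀ j → ¬ (j ≡ i) → IsBot (proj₁ (proj₁ (t j)))) →
       proj₁ (φ t) ≈ₖ lookup Z i)

IsBuildingSet : ∀ {k m} → (PiK k m → Set) → (PiK k m → Set) → Set
IsBuildingSet L B =
  (∀ b → B b → L b × ¬ IsBot (proj₁ b)) ×
  (∀ x → L x → ¬ IsBot (proj₁ x) →
     ∃ λ (Z : List _) →
       (∀ z → MaxBelow B x z → Any (z ≈ₖ_) Z) ×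
       All (MaxBelow B x) Z ×
       AllPairs (λ a b → ¬ (a ≈ₖ b)) Z ×
       ∃ (IsBuildingIso L Z x))

{-# OPTIONS --safe #-}

-- Every member of N has a single non-trivial block, and two members whose non-trivial blocks
-- meet are comparable: otherwise their join u, restricted to its block through a common point,
-- is still an upper bound of both, so minimality forces u itself to have a single non-trivial
-- block; then rk u is the size of that block minus one, a multiple of k, and u ∈ 𝒢, which the
-- definition of 𝒩 forbids.
--
-- For such a laminar family the join of any X ⊆ N is the reflexive closure of the union of the
-- members of X, since at every point the members of X through it form a chain with a largest
-- element. Hence joins exist uniquely, and a member of N below ⋁X lies below a member of X. This
-- gives meets in Σ(N) (join the generators of either argument lying below both), and shows that
-- the maximal members z₁,…,zᵣ of N below x = ⋁X are the maximal members of X. Their non-trivial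
-- blocks are pairwise disjoint, and y ↦ (⋁ of the generators of y below zᵢ)ᵢ inverts the join map
-- ∏ᵢ [0̂, zᵢ] → [0̂, x].

module Submission where

open import Level using (0ℓ)
open import Function.Base using (_∘_; flip)
open import Function.Bundles using (Equivalence)
open import Data.Empty using (⊥-elim)
open import Data.Product using (Σ; ∃; _×_; _,_; proj₁; proj₂)
open import Data.Sum using (_⊎_; inj₁; inj₂)
open import Data.Bool using (Bool; true; false; not; _∨_; _∧_)
open import Data.Bool.Properties using (∧-conicalˡ; ∧-conicalʳ; ∧-zeroʳ; T-≡)
import Data.Bool.Properties as BP
open import Data.Nat using (ℕ; zero; suc; pred; _+_; _*_; _∸_; _≤_; z≤n; s≤s; _≤ᵇ_; _<ᵇ_)
open import Data.Nat.Properties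
  using (≤-antisym; ≤-reflexive; +-comm; +-suc; <⇒<ᵇ; ≤⇒≤ᵇ; ≤ᵇ⇒≤; [m+n]∸[m+o]≡n∸o)
open import Data.Nat.Divisibility using (_∣_; _∣0)
open import Data.Fin using (Fin; toℕ)
import Data.Fin as F
import Data.Fin.Properties as FP
open import Data.List using (List; []; _∷_; _++_; length; lookup; filter; concat; tabulate; deduplicate)
open import Data.List.Membership.Propositional using (_∈_)
open import Data.List.Membership.Propositional.Properties using (∈-lookup; ∈-filter⁺; ∈-filter⁻)
open import Data.List.Relation.Unary.All using (All; []; _∷_)
import Data.List.Relation.Unary.All as All
import Data.List.Relation.Unary.All.Properties as All
open import Data.List.Relation.Unary.Any using (Any; here; there)
import Data.List.Relation.Unary.Any as Any
import Data.List.Relation.Unary.Any.Properties as Any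
open import Data.List.Relation.Unary.AllPairs using (AllPairs; []; _∷_)
import Data.List.Relation.Unary.Unique.Setoid as Unique
open import Data.List.Relation.Unary.Unique.DecSetoid.Properties using (deduplicate-!)
open import Relation.Nullary using (¬_; Dec; yes; no; does; ¬?)
open import Relation.Nullary.Decidable using (dec-true; _×-dec_; _⊎-dec_; _→-dec_)
import Relation.Unary as U
open import Relation.Binary.Core using (Rel)
open import Relation.Binary.Definitions using (Decidable; _Respects_)
open import Relation.Binary.Structures using (IsEquivalence)
open import Relation.Binary.Bundles using (Setoid; Poset; DecSetoid)
open import Relation.Binary.PropositionalEquality
  using (_≡_; _≢_; refl; sym; trans; cong; cong₂; subst; module ≡-Reasoning)
open import Defs

does⁻ : ∀ {a} {A : Set a} (a? : Dec A) → does a? ≡ true → A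
does⁻ (yes a) _ = a

true-⇔⇒≡ : ∀ {a b : Bool} → (a ≡ true → b ≡ true) → (b ≡ true → a ≡ true) → a ≡ b
true-⇔⇒≡ {true}          a⇒b _   = sym (a⇒b refl)
true-⇔⇒≡ {false} {false} _   _   = refl
true-⇔⇒≡ {false} {true}  _   b⇒a = b⇒a refl

not∨⁺ : ∀ {a b} → (a ≡ true → b ≡ true) → not a ∨ b ≡ true
not∨⁺ {true}  a⇒b = a⇒b refl
not∨⁺ {false} _   = refl

not∨⁻ : ∀ {a b} → not a ∨ b ≡ true → a ≡ true → b ≡ true
not∨⁻ {true} b refl = b

countF-cong : ∀ {m} {f g : Fin m → Bool} → (∀ i → f i ≡ g i) → countF f ≡ countF g
countF-cong {zero}  f≗g = refl
countF-cong {suc m} f≗g rewrite f≗g F.zero = cong (_ +_) (countF-cong (f≗g ∘ F.suc))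

countF-false : ∀ {m} {f : Fin m → Bool} → (∀ i → f i ≡ false) → countF f ≡ 0
countF-false {zero}  f≡false = refl
countF-false {suc m} f≡false rewrite f≡false F.zero = countF-false (f≡false ∘ F.suc)

countF≡0⇒false : ∀ {m} (f : Fin m → Bool) → countF f ≡ 0 → ∀ i → f i ≡ false
countF≡0⇒false {suc m} f count≡0 i with f F.zero in f0
countF≡0⇒false {suc m} f count≡0 F.zero    | false = f0
countF≡0⇒false {suc m} f count≡0 (F.suc i) | false = countF≡0⇒false (f ∘ F.suc) count≡0 i

countF-unique : ∀ {m} {f : Fin m → Bool} ℓ → f ℓ ≡ true → (∀ i → f i ≡ true → i ≡ ℓ) →
                countF f ≡ 1
countF-unique {suc m} {f} F.zero fℓ unique rewrite fℓ = cong suc (countF-false rest)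
  where
  rest : ∀ i → f (F.suc i) ≡ false
  rest i with f (F.suc i) in fi
  ... | false = refl
  ... | true with () ← unique (F.suc i) fi
countF-unique {suc m} {f} (F.suc ℓ) fℓ unique with f F.zero in f0
... | true with () ← unique F.zero f0
... | false = countF-unique ℓ fℓ (λ i fi → FP.suc-injective (unique (F.suc i) fi))

countF≡1⇒unique : ∀ {m} (f : Fin m → Bool) → countF f ≡ 1 →
                  ∃ λ ℓ → f ℓ ≡ true × (∀ i → f i ≡ true → i ≡ ℓ)
countF≡1⇒unique {suc m} f count≡1 with f F.zero in f0
... | true = F.zero , f0 , unique
  where
  unique : ∀ i → f i ≡ true → i ≡ F.zero
  unique F.zero    _  = refl
  unique (F.suc i) fi with () ← trans (sym fi) (countF≡0⇒false (f ∘ F.suc) (cong pred count≡1) i)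
... | false with countF≡1⇒unique (f ∘ F.suc) count≡1
... | ℓ , fℓ , unique = F.suc ℓ , fℓ , unique′
  where
  unique′ : ∀ i → f i ≡ true → i ≡ F.suc ℓ
  unique′ F.zero    fi with () ← trans (sym fi) f0
  unique′ (F.suc i) fi = cong F.suc (unique i fi)

countF-true : ∀ m → countF {m} (λ _ → true) ≡ m
countF-true zero    = refl
countF-true (suc m) = cong suc (countF-true m)

countF-split : ∀ {m} (f g : Fin m → Bool) →
               countF f ≡ countF (λ i → f i ∧ g i) + countF (λ i → f i ∧ not (g i))
countF-split {zero}  f g = refl
countF-split {suc m} f g with f F.zero | g F.zero
... | true  | true  = cong suc (countF-split (f ∘ F.suc) (g ∘ F.suc))
... | true  | false = trans (cong suc (countF-split (f ∘ F.suc) (g ∘ F.suc))) (sym (+-suc _ _))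
... | false | true  = countF-split (f ∘ F.suc) (g ∘ F.suc)
... | false | false = countF-split (f ∘ F.suc) (g ∘ F.suc)

countF-pos : ∀ {m} (f : Fin m → Bool) a → f a ≡ true → 1 ≤ countF f
countF-pos {suc m} f a fa with f F.zero in f0
countF-pos {suc m} f a         fa | true  = s≤s z≤n
countF-pos {suc m} f F.zero    fa | false with () ← trans (sym fa) f0
countF-pos {suc m} f (F.suc a) fa | false = countF-pos (f ∘ F.suc) a fa

countF-two : ∀ {m} (f : Fin m → Bool) a b → a ≢ b → f a ≡ true → f b ≡ true → 2 ≤ countF f
countF-two {suc m} f F.zero    F.zero    a≢b _  _  = ⊥-elim (a≢b refl)
countF-two {suc m} f F.zero    (F.suc b) _   fa fb rewrite fa = s≤s (countF-pos (f ∘ F.suc) b fb)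
countF-two {suc m} f (F.suc a) F.zero    _   fa fb rewrite fb = s≤s (countF-pos (f ∘ F.suc) a fa)
countF-two {suc m} f (F.suc a) (F.suc b) a≢b fa fb with f F.zero
... | true  = s≤s (countF-pos (f ∘ F.suc) a fa)
... | false = countF-two (f ∘ F.suc) a b (a≢b ∘ cong F.suc) fa fb

least-true : ∀ {m} (f : Fin m → Bool) a → f a ≡ true →
             ∃ λ μ → f μ ≡ true × (∀ j → f j ≡ true → toℕ μ ≤ toℕ j)
least-true {suc m} f a fa with f F.zero in f0
least-true {suc m} f a         fa | true  = F.zero , f0 , λ _ _ → z≤n
least-true {suc m} f F.zero    fa | false with () ← trans (sym fa) f0
least-true {suc m} f (F.suc a) fa | false with least-true (f ∘ F.suc) a fa
... | μ , fμ , least = F.suc μ , fμ , least′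
  where
  least′ : ∀ j → f j ≡ true → toℕ (F.suc μ) ≤ toℕ j
  least′ F.zero    fj with () ← trans (sym fj) f0
  least′ (F.suc j) fj = s≤s (least j fj)

allF⁺ : ∀ {m} (f : Fin m → Bool) → (∀ i → f i ≡ true) → allF f ≡ true
allF⁺ {zero}  f all = refl
allF⁺ {suc m} f all rewrite all F.zero = allF⁺ (f ∘ F.suc) (all ∘ F.suc)

allF⁻ : ∀ {m} (f : Fin m → Bool) → allF f ≡ true → ∀ i → f i ≡ true
allF⁻ {suc m} f all i with f F.zero in f0
allF⁻ {suc m} f all F.zero    | true = f0
allF⁻ {suc m} f all (F.suc i) | true = allF⁻ (f ∘ F.suc) all i

module _ {a ℓ} (S : Setoid a ℓ) where
  open Setoid S using (_≈_) renaming (Carrier to A; sym to ≈-sym)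
  open Unique S

  lookup-injective : ∀ {xs : List A} → Unique xs → ∀ i j → lookup xs i ≈ lookup xs j → i ≡ j
  lookup-injective (_ ∷ _)     F.zero    F.zero    _   = refl
  lookup-injective (x≉ ∷ _)    F.zero    (F.suc j) x≈y = ⊥-elim (All.lookup x≉ (∈-lookup j) x≈y)
  lookup-injective (x≉ ∷ _)    (F.suc i) F.zero    y≈x = ⊥-elim (All.lookup x≉ (∈-lookup i) (≈-sym y≈x))
  lookup-injective (_ ∷ pairs) (F.suc i) (F.suc j) i≈j = cong F.suc (lookup-injective pairs i j i≈j)

All-filter⁺ : ∀ {A : Set} {P Q : A → Set} (P? : U.Decidable P) {xs} →
              All (λ x → P x → Q x) xs → All Q (filter P? xs)
All-filter⁺ P? P⇒Q = All.tabulate λ x∈ →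
  let x∈xs , px = ∈-filter⁻ P? x∈ in All.lookup P⇒Q x∈xs px

-- Partitions with a single non-trivial block

module _ {m : ℕ} where
  open ≡-Reasoning

  fromDecEquivalence : {_~_ : Rel (Fin m) 0ℓ} → Decidable _~_ → IsEquivalence _~_ → Partition m
  fromDecEquivalence _~?_ isEq = record
    { R       = λ i j → does (i ~? j)
    ; R-refl  = λ i → dec-true (i ~? i) E.refl
    ; R-sym   = λ i j i~j → dec-true (j ~? i) (E.sym (does⁻ (i ~? j) i~j))
    ; R-trans = λ i j l i~j j~l →
                  dec-true (i ~? l) (E.trans (does⁻ (i ~? j) i~j) (does⁻ (j ~? l) j~l))
    }
    where module E = IsEquivalence isEq

  NonSingleton : Partition m → Fin m → Set
  NonSingleton x a = ∃ λ b → b ≢ a × R x a b ≡ true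

  nonSingleton? : ∀ x a → Dec (NonSingleton x a)
  nonSingleton? x a = FP.any? (λ b → ¬? (b FP.≟ a) ×-dec (R x a b BP.≟ true))

  SingleBlock : Partition m → Set
  SingleBlock x = ∀ a c → NonSingleton x a → NonSingleton x c → R x a c ≡ true

  _⊑?_ : Decidable (_⊑_ {m})
  x ⊑? y = FP.all? λ i → FP.all? λ j → (R x i j BP.≟ true) →-dec (R y i j BP.≟ true)

  singleton-block : ∀ x {i j} → ¬ NonSingleton x i → R x i j ≡ true → j ≡ i
  singleton-block x {i} {j} singleton r with j FP.≟ i
  ... | yes j≡i = j≡i
  ... | no  j≢i = ⊥-elim (singleton (j , j≢i , r))

  blockSize-singleton : ∀ (x : Partition m) i → (∀ j → R x i j ≡ true → j ≡ i) →
                        blockSize x i ≡ 1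
  blockSize-singleton x i = countF-unique i (R-refl x i)

  nonSingleton-mono : ∀ x y {a} → x ⊑ y → NonSingleton x a → NonSingleton y a
  nonSingleton-mono x y {a} x⊑y (b , b≢a , r) = b , b≢a , x⊑y a b r

  nonSingleton-resp : ∀ x {a c} → R x a c ≡ true → NonSingleton x a → NonSingleton x c
  nonSingleton-resp x {a} {c} rac (b , b≢a , rab) with a FP.≟ c
  ... | no  a≢c = a , a≢c , R-sym x a c rac
  ... | yes refl = b , b≢a , rab

  nonSingleton⇒bigBlock : ∀ x {a} → NonSingleton x a → (1 <ᵇ blockSize x a) ≡ true
  nonSingleton⇒bigBlock x {a} (b , b≢a , r) =
    Equivalence.to T-≡ (<⇒<ᵇ (countF-two (R x a) a b (b≢a ∘ sym) (R-refl x a) r))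

  bigBlock⇒nonSingleton : ∀ x a → (1 <ᵇ blockSize x a) ≡ true → NonSingleton x a
  bigBlock⇒nonSingleton x a big with nonSingleton? x a
  ... | yes ns = ns
  ... | no singleton with () ← trans (sym big)
          (cong (1 <ᵇ_) (blockSize-singleton x a (λ j → singleton-block x singleton)))

  singleBlock-member : ∀ x → SingleBlock x → ∀ {p} → NonSingleton x p →
                       ∀ {i j} → i ≢ j → R x i j ≡ true → R x p i ≡ true
  singleBlock-member x single nsp {i} {j} i≢j r = single _ i nsp (j , i≢j ∘ sym , r)

  private
    leaderTest : Partition m → Fin m → Fin m → Bool
    leaderTest x i j = not (R x i j) ∨ (toℕ i ≤ᵇ toℕ j)

  isLeader⁺ : ∀ x i → (∀ j → R x i j ≡ true → toℕ i ≤ toℕ j) → isLeader x i ≡ true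
  isLeader⁺ x i least =
    allF⁺ (leaderTest x i) λ j → not∨⁺ (Equivalence.to T-≡ ∘ ≤⇒≤ᵇ ∘ least j)

  isLeader⁻ : ∀ x {i} → isLeader x i ≡ true → ∀ j → R x i j ≡ true → toℕ i ≤ toℕ j
  isLeader⁻ x {i} leader j r =
    ≤ᵇ⇒≤ (toℕ i) (toℕ j)
      (Equivalence.from T-≡ (not∨⁻ (allF⁻ (leaderTest x i) leader j) r))

  leaderOf : ∀ x a → ∃ λ μ → R x a μ ≡ true × isLeader x μ ≡ true
  leaderOf x a with least-true (R x a) a (R-refl x a)
  ... | μ , aμ , least = μ , aμ , isLeader⁺ x μ λ j μj → least j (R-trans x a μ j aμ μj)

  leader-unique : ∀ x {i j} → isLeader x i ≡ true → isLeader x j ≡ true →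
                  R x i j ≡ true → i ≡ j
  leader-unique x {i} {j} li lj r =
    FP.toℕ-injective (≤-antisym (isLeader⁻ x li j r) (isLeader⁻ x lj i (R-sym x i j r)))

  InI⇒nonSingleton : ∀ x → InI x → ∃ (NonSingleton x)
  InI⇒nonSingleton x inI with countF≡1⇒unique _ inI
  ... | ℓ , leader∧big , _ = ℓ , bigBlock⇒nonSingleton x ℓ (∧-conicalʳ _ _ leader∧big)

  InI⇒singleBlock : ∀ x → InI x → SingleBlock x
  InI⇒singleBlock x inI a c nsa nsc with countF≡1⇒unique _ inI
  ... | ℓ , _ , unique = R-trans x a ℓ c (toℓ nsa) (R-sym x c ℓ (toℓ nsc))
    where
    toℓ : ∀ {b} → NonSingleton x b → R x b ℓ ≡ true
    toℓ {b} nsb with leaderOf x b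
    ... | μ , bμ , leader with unique μ (cong₂ _∧_ leader
                                (nonSingleton⇒bigBlock x (nonSingleton-resp x bμ nsb)))
    ... | refl = bμ

  module _ (x : Partition m) (single : SingleBlock x) {p : Fin m} (nsp : NonSingleton x p) where

    private
      inBlock : Fin m → Bool
      inBlock = R x p

      μ : Fin m
      μ = proj₁ (leaderOf x p)

      pμ : R x p μ ≡ true
      pμ = proj₁ (proj₂ (leaderOf x p))

      μ-leader : isLeader x μ ≡ true
      μ-leader = proj₂ (proj₂ (leaderOf x p))

      leader-inBlock : ∀ i → isLeader x i ≡ true → inBlock i ≡ true → i ≡ μ
      leader-inBlock i li pi = leader-unique x li μ-leader (R-trans x i p μ (R-sym x p i pi) pμ)

      outside-leader : ∀ i → inBlock i ≡ false → isLeader x i ≡ true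
      outside-leader i outside = isLeader⁺ x i λ j r →
        ≤-reflexive (cong toℕ (sym (singleton-block x outside-singleton r)))
        where
        outside-singleton : ¬ NonSingleton x i
        outside-singleton nsi with () ← trans (sym outside) (single p i nsp nsi)

      leaders-inBlock : countF (λ i → isLeader x i ∧ inBlock i) ≡ 1
      leaders-inBlock = countF-unique μ (cong₂ _∧_ μ-leader pμ) λ i l∧b →
        leader-inBlock i (∧-conicalˡ _ _ l∧b) (∧-conicalʳ _ _ l∧b)

      leaders-outside : countF (λ i → isLeader x i ∧ not (inBlock i)) ≡ countF (not ∘ inBlock)
      leaders-outside = countF-cong λ i → by-inBlock i (inBlock i) refl
        where
        by-inBlock : ∀ i b → inBlock i ≡ b → isLeader x i ∧ not b ≡ not b
        by-inBlock i true  _       = ∧-zeroʳ _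
        by-inBlock i false outside = cong (_∧ true) (outside-leader i outside)

      numBlocks≡ : numBlocks x ≡ 1 + countF (not ∘ inBlock)
      numBlocks≡ = begin
        countF (isLeader x)
          ≡⟨ countF-split (isLeader x) inBlock ⟩
        countF (λ i → isLeader x i ∧ inBlock i) + countF (λ i → isLeader x i ∧ not (inBlock i))
          ≡⟨ cong₂ _+_ leaders-inBlock leaders-outside ⟩
        1 + countF (not ∘ inBlock)
          ∎

    singleBlock⇒InI : InI x
    singleBlock⇒InI =
      countF-unique μ (cong₂ _∧_ μ-leader (nonSingleton⇒bigBlock x (nonSingleton-resp x pμ nsp)))
      λ i leader∧big → leader-inBlock i (∧-conicalˡ _ _ leader∧big)
        (single p i nsp (bigBlock⇒nonSingleton x i (∧-conicalʳ _ _ leader∧big)))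

    singleBlock-rk : rk x ≡ blockSize x p ∸ 1
    singleBlock-rk = begin
      m ∸ numBlocks x              ≡⟨ cong₂ _∸_ (sym m≡) numBlocks≡ ⟩
      (A + B) ∸ (1 + B)            ≡⟨ cong₂ _∸_ (+-comm A B) (+-comm 1 B) ⟩
      (B + A) ∸ (B + 1)            ≡⟨ [m+n]∸[m+o]≡n∸o B A 1 ⟩
      A ∸ 1                        ∎
      where
      A B : ℕ
      A = countF inBlock
      B = countF (not ∘ inBlock)
      m≡ : A + B ≡ m
      m≡ = trans (sym (countF-split (λ _ → true) inBlock)) (countF-true m)

  singleBlock⇒InG : ∀ k x → AllBlocks1modk k x → SingleBlock x →
                    ∀ {p} → NonSingleton x p → InG k x
  singleBlock⇒InG k x 1modk single nsp =
    singleBlock⇒InI x single nsp , subst (k ∣_) (sym (singleBlock-rk x single nsp)) (1modk _)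

  -- Restricting a partition to one of its blocks

  module _ (u : Partition m) (p : Fin m) where

    private
      _~_ : Rel (Fin m) 0ℓ
      i ~ j = (R u p i ≡ true × R u p j ≡ true) ⊎ i ≡ j

      _~?_ : Decidable _~_
      i ~? j = ((R u p i BP.≟ true) ×-dec (R u p j BP.≟ true)) ⊎-dec (i FP.≟ j)

      ~-isEquivalence : IsEquivalence _~_
      ~-isEquivalence = record
        { refl  = inj₂ refl
        ; sym   = λ { (inj₁ (pi , pj)) → inj₁ (pj , pi) ; (inj₂ refl) → inj₂ refl }
        ; trans = λ { (inj₂ refl) j~l → j~l
                    ; i~j (inj₂ refl) → i~j
                    ; (inj₁ (pi , _)) (inj₁ (_ , pl)) → inj₁ (pi , pl) }
        }

    restrictToBlock : Partition m
    restrictToBlock = fromDecEquivalence _~?_ ~-isEquivalence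

    restrictToBlock-⊑ : restrictToBlock ⊑ u
    restrictToBlock-⊑ i j r with does⁻ (i ~? j) r
    ... | inj₁ (pi , pj) = R-trans u i p j (R-sym u p i pi) pj
    ... | inj₂ refl      = R-refl u i

    ⊑-restrictToBlock : ∀ z → SingleBlock z → NonSingleton z p → z ⊑ u → z ⊑ restrictToBlock
    ⊑-restrictToBlock z single nsp z⊑u i j r = dec-true (i ~? j) (related i j r)
      where
      related : ∀ i j → R z i j ≡ true → i ~ j
      related i j r with i FP.≟ j
      ... | yes i≡j = inj₂ i≡j
      ... | no  i≢j = inj₁ (z⊑u p i pi , z⊑u p j (R-trans z p i j pi r))
        where
        pi : R z p i ≡ true
        pi = singleBlock-member z single nsp i≢j r

    ⊑-restrictToBlock⇒singleBlock : u ⊑ restrictToBlock → SingleBlock u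
    ⊑-restrictToBlock⇒singleBlock u⊑ a c nsa nsc =
      R-trans u a p c (R-sym u p a (inBlock nsa)) (inBlock nsc)
      where
      inBlock : ∀ {a} → NonSingleton u a → R u p a ≡ true
      inBlock {a} (b , b≢a , r) with does⁻ (a ~? b) (u⊑ a b r)
      ... | inj₁ (pa , _) = pa
      ... | inj₂ a≡b      = ⊥-elim (b≢a (sym a≡b))

    restrictToBlock-blockSize : ∀ i → blockSize restrictToBlock i ≡ blockSize u i
                                    ⊎ blockSize restrictToBlock i ≡ 1
    restrictToBlock-blockSize i = byMembership (R u p i) refl
      where
      byMembership : ∀ b → R u p i ≡ b → blockSize restrictToBlock i ≡ blockSize u i
                                        ⊎ blockSize restrictToBlock i ≡ 1
      byMembership true pi =
        inj₁ (countF-cong λ j →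
                true-⇔⇒≡ (to j ∘ does⁻ (i ~? j)) (dec-true (i ~? j) ∘ from j))
        where
        to : ∀ j → i ~ j → R u i j ≡ true
        to j (inj₁ (_ , pj)) = R-trans u i p j (R-sym u p i pi) pj
        to j (inj₂ refl)     = R-refl u i
        from : ∀ j → R u i j ≡ true → i ~ j
        from j r = inj₁ (pi , R-trans u p i j pi r)
      byMembership false pi =
        inj₂ (blockSize-singleton restrictToBlock i λ j r → sym (only-i j (does⁻ (i ~? j) r)))
        where
        only-i : ∀ j → i ~ j → i ≡ j
        only-i j (inj₂ i≡j)       = i≡j
        only-i j (inj₁ (pi′ , _)) with () ← trans (sym pi) pi′

    restrictToBlock-1modk : ∀ k → AllBlocks1modk k u → AllBlocks1modk k restrictToBlock
    restrictToBlock-1modk k 1modk i with restrictToBlock-blockSize i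
    ... | inj₁ same = subst (λ s → k ∣ s ∸ 1) (sym same) (1modk i)
    ... | inj₂ one  = subst (λ s → k ∣ s ∸ 1) (sym one) (k ∣0)

-- The order of Π⁽ᵏ⁾ₘ and laminar families

module _ {k m : ℕ} where

  ≤ₖ-refl : ∀ (x : PiK k m) → x ≤ₖ x
  ≤ₖ-refl x i j r = r

  ≤ₖ-poset : Poset 0ℓ 0ℓ 0ℓ
  ≤ₖ-poset = record
    { Carrier        = PiK k m
    ; _≈_            = _≈ₖ_
    ; _≤_            = _≤ₖ_
    ; isPartialOrder = record
      { isPreorder = record
        { isEquivalence = record
          { refl  = λ {x} → ≤ₖ-refl x , ≤ₖ-refl x
          ; sym   = λ (x≤y , y≤x) → y≤x , x≤y
          ; trans = λ {x} {y} {z} (x≤y , y≤x) (y≤z , z≤y) →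
                      ≤ₖ-trans {x} {y} {z} x≤y y≤z , ≤ₖ-trans {z} {y} {x} z≤y y≤x
          }
        ; reflexive     = proj₁
        ; trans         = λ {x} {y} {z} → ≤ₖ-trans {x} {y} {z}
        }
      ; antisym    = _,_
      }
    }
    where
    ≤ₖ-trans : ∀ {x y z : PiK k m} → x ≤ₖ y → y ≤ₖ z → x ≤ₖ z
    ≤ₖ-trans x≤y y≤z i j r = y≤z i j (x≤y i j r)

  _≤ₖ?_ : Decidable (_≤ₖ_ {k} {m})
  x ≤ₖ? y = proj₁ x ⊑? proj₁ y

  _≈ₖ?_ : Decidable (_≈ₖ_ {k} {m})
  x ≈ₖ? y = (x ≤ₖ? y) ×-dec (y ≤ₖ? x)

  ≈ₖ-decSetoid : DecSetoid 0ℓ 0ℓ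
  ≈ₖ-decSetoid = record
    { isDecEquivalence = record { isEquivalence = Poset.isEquivalence ≤ₖ-poset ; _≟_ = _≈ₖ?_ } }

  upperBound-≤ : ∀ {X} a b → UpperBound X a → a ≤ₖ b → UpperBound X b
  upperBound-≤ a b X≤a a≤b = All.map (λ {x} x≤a → begin x ≤⟨ x≤a ⟩ a ≤⟨ a≤b ⟩ b ∎) X≤a
    where open import Relation.Binary.Reasoning.PartialOrder ≤ₖ-poset

  ≈ₖ-respˡ : ∀ (z : PiK k m) → (z ≈ₖ_) Respects (flip _≈ₖ_)
  ≈ₖ-respˡ z {u} {v} (v≤u , u≤v) (z≤u , u≤z) =
    (begin z ≤⟨ z≤u ⟩ u ≤⟨ u≤v ⟩ v ∎) , (begin v ≤⟨ v≤u ⟩ u ≤⟨ u≤z ⟩ z ∎)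
    where open import Relation.Binary.Reasoning.PartialOrder ≤ₖ-poset

  IsMaximalIn : List (PiK k m) → PiK k m → Set
  IsMaximalIn X w = All (λ v → w ≤ₖ v → v ≤ₖ w) X

  isMaximalIn? : ∀ X → U.Decidable (IsMaximalIn X)
  isMaximalIn? X w = All.all? (λ v → (w ≤ₖ? v) →-dec (v ≤ₖ? w)) X

  Laminar : (PiK k m → Set) → Set
  Laminar N = ∀ {x y} → N x → N y → ∀ {p} →
              NonSingleton (proj₁ x) p → NonSingleton (proj₁ y) p → x ≤ₖ y ⊎ y ≤ₖ x

  record IsLaminarFamily (N : PiK k m → Set) : Set where
    field
      singleBlock : ∀ {x} → N x → SingleBlock (proj₁ x)
      nonTrivial  : ∀ {x} → N x → ∃ (NonSingleton (proj₁ x))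
      laminar     : Laminar N

  module _ {N : PiK k m → Set} (𝒩 : InNFamily k m N) where
    open InNFamily 𝒩

    𝒩-singleBlock : ∀ {x} → N x → SingleBlock (proj₁ x)
    𝒩-singleBlock {x} nx = InI⇒singleBlock (proj₁ x) (proj₁ (subsetG x nx))

    𝒩-laminar : Laminar N
    𝒩-laminar {x} {y} nx ny {p} nsx nsy with x ≤ₖ? y | y ≤ₖ? x
    ... | yes x≤y | _       = inj₁ x≤y
    ... | no _    | yes y≤x = inj₂ y≤x
    ... | no x≰y  | no y≰x
      with joins (x ∷ y ∷ []) (nx ∷ ny ∷ []) (((x≰y , y≰x) ∷ []) ∷ [] ∷ []) (s≤s (s≤s z≤n))
    ... | u , ((x≤u ∷ y≤u ∷ [] , minimal) , _) , u∉𝒢 = ⊥-elim (u∉𝒢 u∈𝒢)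
      where
      u′ : PiK k m
      u′ = restrictToBlock (proj₁ u) p , restrictToBlock-1modk (proj₁ u) p k (proj₂ u)
      below-u′ : ∀ {z} → N z → NonSingleton (proj₁ z) p → z ≤ₖ u → z ≤ₖ u′
      below-u′ {z} nz nsz = ⊑-restrictToBlock (proj₁ u) p (proj₁ z) (𝒩-singleBlock nz) nsz
      u≤u′ : u ≤ₖ u′
      u≤u′ = minimal u′ (below-u′ nx nsx x≤u ∷ below-u′ ny nsy y≤u ∷ [])
                        (restrictToBlock-⊑ (proj₁ u) p)
      u∈𝒢 : InG k (proj₁ u)
      u∈𝒢 = singleBlock⇒InG k (proj₁ u) (proj₂ u)
              (⊑-restrictToBlock⇒singleBlock (proj₁ u) p u≤u′)
              (nonSingleton-mono (proj₁ x) (proj₁ u) x≤u nsx)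

    𝒩-isLaminarFamily : IsLaminarFamily N
    𝒩-isLaminarFamily = record
      { singleBlock = 𝒩-singleBlock
      ; nonTrivial  = λ {x} nx → InI⇒nonSingleton (proj₁ x) (proj₁ (subsetG x nx))
      ; laminar     = 𝒩-laminar
      }

-- Joins of a laminar family

module LaminarJoin {k m : ℕ} {N : PiK k m → Set} (laminar : Laminar N) where
  open import Relation.Binary.Reasoning.PartialOrder (≤ₖ-poset {k} {m})

  _∼[_]_ : Fin m → List (PiK k m) → Fin m → Set
  i ∼[ X ] j = i ≡ j ⊎ Any (λ x → R (proj₁ x) i j ≡ true) X

  ∼-member : ∀ {X x i j} → x ∈ X → R (proj₁ x) i j ≡ true → i ∼[ X ] j
  ∼-member x∈X r = inj₂ (Any.map (λ { refl → r }) x∈X)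

  record LargestThrough (X : List (PiK k m)) (i : Fin m) : Set where
    constructor largest
    field
      top     : PiK k m
      top∈X   : top ∈ X
      top-ns  : NonSingleton (proj₁ top) i
      top-max : All (λ y → NonSingleton (proj₁ y) i → y ≤ₖ top) X

  open LargestThrough public

  largestThrough : ∀ {X} → All N X → ∀ i →
                   All (λ y → ¬ NonSingleton (proj₁ y) i) X ⊎ LargestThrough X i
  largestThrough [] i = inj₁ []
  largestThrough {y ∷ X} (ny ∷ NX) i with nonSingleton? (proj₁ y) i | largestThrough NX i
  ... | no ¬ns | inj₁ none = inj₁ (¬ns ∷ none)
  ... | no ¬ns | inj₂ (largest t t∈X nst max) =
    inj₂ (largest t (there t∈X) nst ((⊥-elim ∘ ¬ns) ∷ max))
  ... | yes ns | inj₁ none =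
    inj₂ (largest y (here refl) ns ((λ _ → ≤ₖ-refl y) ∷ All.map (λ ¬ns′ → ⊥-elim ∘ ¬ns′) none))
  ... | yes ns | inj₂ (largest t t∈X nst max) with laminar ny (All.lookup NX t∈X) ns nst
  ...   | inj₁ y≤t = inj₂ (largest t (there t∈X) nst ((λ _ → y≤t) ∷ max))
  ...   | inj₂ t≤y =
    inj₂ (largest y (here refl) ns ((λ _ → ≤ₖ-refl y) ∷ All.map (λ {w} → below-y w) max))
    where
    below-y : ∀ w → (NonSingleton (proj₁ w) i → w ≤ₖ t) → NonSingleton (proj₁ w) i → w ≤ₖ y
    below-y w w≤t ns′ = begin w ≤⟨ w≤t ns′ ⟩ t ≤⟨ t≤y ⟩ y ∎

  ∼-none : ∀ {X i j} → All (λ y → ¬ NonSingleton (proj₁ y) i) X → i ∼[ X ] j → i ≡ j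
  ∼-none none (inj₁ i≡j) = i≡j
  ∼-none none (inj₂ any) with All.lookupAny none any
  ... | ¬ns , r = sym (singleton-block (proj₁ (Any.lookup any)) ¬ns r)

  ∼-largest : ∀ {X i j} (L : LargestThrough X i) → i ∼[ X ] j → R (proj₁ (top L)) i j ≡ true
  ∼-largest L (inj₁ refl) = R-refl (proj₁ (top L)) _
  ∼-largest {i = i} {j} L (inj₂ any) with All.lookupAny (top-max L) any | j FP.≟ i
  ... | _         , _ | yes refl = R-refl (proj₁ (top L)) i
  ... | y≤top , r     | no j≢i   = y≤top (j , j≢i , r) i j r

  ∼-sym : ∀ {X i j} → i ∼[ X ] j → j ∼[ X ] i
  ∼-sym (inj₁ i≡j) = inj₁ (sym i≡j)
  ∼-sym (inj₂ any) = inj₂ (Any.map (λ {x} → R-sym (proj₁ x) _ _) any)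

  ∼-isEquivalence : ∀ {X} → All N X → IsEquivalence (_∼[ X ]_)
  ∼-isEquivalence {X} NX = record { refl = inj₁ refl ; sym = ∼-sym ; trans = ∼-trans }
    where
    ∼-trans : ∀ {i j l} → i ∼[ X ] j → j ∼[ X ] l → i ∼[ X ] l
    ∼-trans {i} {j} {l} i∼j j∼l with largestThrough NX j
    ... | inj₁ none = subst (i ∼[ X ]_) (∼-none none j∼l) i∼j
    ... | inj₂ L    = ∼-member (top∈X L) (R-trans t i j l (R-sym t j i (∼-largest L (∼-sym i∼j)))
                                                          (∼-largest L j∼l))
      where
      t : Partition m
      t = proj₁ (top L)

  _∼[_]?_ : ∀ i X j → Dec (i ∼[ X ] j)
  i ∼[ X ]? j = (i FP.≟ j) ⊎-dec Any.any? (λ x → R (proj₁ x) i j BP.≟ true) X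

  joinPartition : ∀ X → All N X → Partition m
  joinPartition X NX = fromDecEquivalence (λ i j → i ∼[ X ]? j) (∼-isEquivalence NX)

  joinPartition-1modk : ∀ {X} (NX : All N X) → AllBlocks1modk k (joinPartition X NX)
  joinPartition-1modk {X} NX i with largestThrough NX i
  ... | inj₁ none = subst (λ s → k ∣ s ∸ 1)
          (sym (blockSize-singleton (joinPartition X NX) i λ j r →
                  sym (∼-none none (does⁻ (i ∼[ X ]? j) r))))
          (k ∣0)
  ... | inj₂ L = subst (λ s → k ∣ s ∸ 1)
          (sym (countF-cong λ j → true-⇔⇒≡ (∼-largest L ∘ does⁻ (i ∼[ X ]? j))
                                           (dec-true (i ∼[ X ]? j) ∘ ∼-member (top∈X L))))
          (proj₂ (top L) i)

  ⋁ : ∀ X → All N X → PiK k m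
  ⋁ X NX = joinPartition X NX , joinPartition-1modk NX

  ⋁-upper : ∀ {X} NX {x} → x ∈ X → x ≤ₖ ⋁ X NX
  ⋁-upper {X} NX x∈X i j r = dec-true (i ∼[ X ]? j) (∼-member x∈X r)

  ⋁-least : ∀ {X} NX v → All (_≤ₖ v) X → ⋁ X NX ≤ₖ v
  ⋁-least {X} NX v X≤v i j r with does⁻ (i ∼[ X ]? j) r
  ... | inj₁ refl = R-refl (proj₁ v) i
  ... | inj₂ any with All.lookupAny X≤v any
  ...   | x≤v , rx = x≤v i j rx

  ⋁-minUpperBound : ∀ {X} NX → MinUpperBound X (⋁ X NX)
  ⋁-minUpperBound NX = All.tabulate (⋁-upper NX) , λ v ub _ → ⋁-least NX v ub

  minUpperBound⇒≤⋁ : ∀ {X} NX v → MinUpperBound X v → v ≤ₖ ⋁ X NX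
  minUpperBound⇒≤⋁ NX v (ub , minimal) =
    minimal (⋁ _ NX) (All.tabulate (⋁-upper NX)) (⋁-least NX v ub)

  ≤mub⇒≤⋁ : ∀ {X} NX y v → MinUpperBound X v → y ≤ₖ v → y ≤ₖ ⋁ X NX
  ≤mub⇒≤⋁ NX y v mub y≤v = begin y ≤⟨ y≤v ⟩ v ≤⟨ minUpperBound⇒≤⋁ NX v mub ⟩ ⋁ _ NX ∎

  ⋁-isUniqueJoin : ∀ {X} NX → IsUniqueJoin X (⋁ X NX)
  ⋁-isUniqueJoin NX =
    ⋁-minUpperBound NX , λ v mub → minUpperBound⇒≤⋁ NX v mub , ⋁-least NX v (proj₁ mub)

  ⋁-mono : ∀ {X Y} NX NY → (∀ {x} → x ∈ X → x ∈ Y) → ⋁ X NX ≤ₖ ⋁ Y NY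
  ⋁-mono {Y = Y} NX NY X⊆Y = ⋁-least NX (⋁ Y NY) (All.tabulate (⋁-upper NY ∘ X⊆Y))

  top-maximal : ∀ {X i} (L : LargestThrough X i) → IsMaximalIn X (top L)
  top-maximal L = All.map (λ {y} max top≤y →
    max (nonSingleton-mono (proj₁ (top L)) (proj₁ y) top≤y (top-ns L))) (top-max L)

-- Σ(N) for a laminar family N

module LaminarFamily {k m : ℕ} {N : PiK k m → Set} (F : IsLaminarFamily N) where
  open IsLaminarFamily F
  open LaminarJoin {k} {m} {N} laminar public
  open import Relation.Binary.Reasoning.PartialOrder (≤ₖ-poset {k} {m})

  below-⋁ : ∀ {X} (NX : All N X) {z} → N z → z ≤ₖ ⋁ X NX → ∀ {a} → NonSingleton (proj₁ z) a →
            Σ (LargestThrough X a) λ L → z ≤ₖ top L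
  below-⋁ {X} NX {z} nz z≤⋁ {a} nsa@(b , b≢a , rab) with largestThrough NX a
  ... | inj₁ none = ⊥-elim (b≢a (sym (∼-none none (does⁻ (a ∼[ X ]? b) (z≤⋁ a b rab)))))
  ... | inj₂ L    = L , z≤top
    where
    t : Partition m
    t = proj₁ (top L)
    inTop : ∀ {c} → R (proj₁ z) a c ≡ true → R t a c ≡ true
    inTop {c} rac = ∼-largest L (does⁻ (a ∼[ X ]? c) (z≤⋁ a c rac))
    z≤top : z ≤ₖ top L
    z≤top c d rcd with c FP.≟ d
    ... | yes refl = R-refl t c
    ... | no  c≢d  = R-trans t c a d (R-sym t a c (inTop rac)) (inTop (R-trans (proj₁ z) a c d rac rcd))
      where
      rac : R (proj₁ z) a c ≡ true
      rac = singleBlock-member (proj₁ z) (singleBlock nz) nsa c≢d rcd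

  Σ𝒩 : PiK k m → Set
  Σ𝒩 = InSigma N

  ⋁-Σ𝒩 : ∀ {X} (NX : All N X) → Σ𝒩 (⋁ X NX)
  ⋁-Σ𝒩 NX = _ , NX , ⋁-minUpperBound NX

  Σ𝒩-lub : ∀ a b → Σ𝒩 a → Σ𝒩 b → ∃ (IsLUBIn Σ𝒩 a b)
  Σ𝒩-lub a b (X , NX , mubX) (Y , NY , mubY) = ⋁ (X ++ Y) NXY , ⋁-Σ𝒩 NXY , a≤ , b≤ , least
    where
    NXY : All N (X ++ Y)
    NXY = All.++⁺ NX NY
    a≤ : a ≤ₖ ⋁ (X ++ Y) NXY
    a≤ = begin
      a              ≤⟨ minUpperBound⇒≤⋁ NX a mubX ⟩
      ⋁ X NX         ≤⟨ ⋁-mono NX NXY Any.++⁺ˡ ⟩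
      ⋁ (X ++ Y) NXY ∎
    b≤ : b ≤ₖ ⋁ (X ++ Y) NXY
    b≤ = begin
      b              ≤⟨ minUpperBound⇒≤⋁ NY b mubY ⟩
      ⋁ Y NY         ≤⟨ ⋁-mono NY NXY (Any.++⁺ʳ X) ⟩
      ⋁ (X ++ Y) NXY ∎
    least : ∀ w → Σ𝒩 w → a ≤ₖ w → b ≤ₖ w → ⋁ (X ++ Y) NXY ≤ₖ w
    least w _ a≤w b≤w =
      ⋁-least NXY w (All.++⁺ (upperBound-≤ a w (proj₁ mubX) a≤w)
                             (upperBound-≤ b w (proj₁ mubY) b≤w))

  N-below-both : ∀ a b {X Y} (NX : All N X) (NY : All N Y) → MinUpperBound X a → MinUpperBound Y b →
                 ∀ {y} → N y → y ≤ₖ a → y ≤ₖ b →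
                 ∃ λ v → v ∈ X ++ Y × (v ≤ₖ a × v ≤ₖ b) × y ≤ₖ v
  N-below-both a b {X} NX NY mubX@(X≤a , _) mubY@(Y≤b , _) {y} ny y≤a y≤b with nonTrivial ny
  ... | p , nsp
    with below-⋁ NX ny (≤mub⇒≤⋁ NX y a mubX y≤a) nsp
       | below-⋁ NY ny (≤mub⇒≤⋁ NY y b mubY y≤b) nsp
  ... | Lx , y≤x | Ly , y≤y′
    with laminar (All.lookup NX (top∈X Lx)) (All.lookup NY (top∈X Ly)) (top-ns Lx) (top-ns Ly)
  ... | inj₁ x≤y′ = top Lx , Any.++⁺ˡ (top∈X Lx) , (All.lookup X≤a (top∈X Lx) , x≤b) , y≤x
    where
    x≤b : top Lx ≤ₖ b
    x≤b = begin top Lx ≤⟨ x≤y′ ⟩ top Ly ≤⟨ All.lookup Y≤b (top∈X Ly) ⟩ b ∎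
  ... | inj₂ y′≤x = top Ly , Any.++⁺ʳ X (top∈X Ly) , (y′≤a , All.lookup Y≤b (top∈X Ly)) , y≤y′
    where
    y′≤a : top Ly ≤ₖ a
    y′≤a = begin top Ly ≤⟨ y′≤x ⟩ top Lx ≤⟨ All.lookup X≤a (top∈X Lx) ⟩ a ∎

  Σ𝒩-glb : ∀ a b → Σ𝒩 a → Σ𝒩 b → ∃ (IsGLBIn Σ𝒩 a b)
  Σ𝒩-glb a b (X , NX , mubX) (Y , NY , mubY) = ⋁ C NC , ⋁-Σ𝒩 NC , C≤a , C≤b , greatest
    where
    below-both? : U.Decidable (λ w → w ≤ₖ a × w ≤ₖ b)
    below-both? w = (w ≤ₖ? a) ×-dec (w ≤ₖ? b)
    C : List (PiK k m)
    C = filter below-both? (X ++ Y)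
    NC : All N C
    NC = All.filter⁺ below-both? (All.++⁺ NX NY)
    C≤a : ⋁ C NC ≤ₖ a
    C≤a = ⋁-least NC a (All.map proj₁ (All.all-filter below-both? (X ++ Y)))
    C≤b : ⋁ C NC ≤ₖ b
    C≤b = ⋁-least NC b (All.map proj₂ (All.all-filter below-both? (X ++ Y)))

    generator≤ : ∀ w (W : List (PiK k m)) → All N W → UpperBound W w → w ≤ₖ a → w ≤ₖ b →
                 ∀ {y} → y ∈ W → y ≤ₖ ⋁ C NC
    generator≤ w W NW W≤w w≤a w≤b {y} y∈W
      with N-below-both a b NX NY mubX mubY (All.lookup NW y∈W)
             (begin y ≤⟨ All.lookup W≤w y∈W ⟩ w ≤⟨ w≤a ⟩ a ∎)
             (begin y ≤⟨ All.lookup W≤w y∈W ⟩ w ≤⟨ w≤b ⟩ b ∎)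
    ... | v , v∈ , v≤a∧b , y≤v =
      begin y ≤⟨ y≤v ⟩ v ≤⟨ ⋁-upper NC (∈-filter⁺ below-both? v∈ v≤a∧b) ⟩ ⋁ C NC ∎

    greatest : ∀ w → Σ𝒩 w → w ≤ₖ a → w ≤ₖ b → w ≤ₖ ⋁ C NC
    greatest w (W , NW , mubW) w≤a w≤b = begin
      w        ≤⟨ minUpperBound⇒≤⋁ NW w mubW ⟩
      ⋁ W NW   ≤⟨ ⋁-least NW (⋁ C NC) (All.tabulate (generator≤ w W NW (proj₁ mubW) w≤a w≤b)) ⟩
      ⋁ C NC   ∎

  Σ𝒩-isLattice : IsLatticeSub Σ𝒩
  Σ𝒩-isLattice a b σa σb = Σ𝒩-lub a b σa σb , Σ𝒩-glb a b σa σb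

  module Components (x : PiK k m) {X : List (PiK k m)} (NX : All N X) (mubX : MinUpperBound X x) where

    below-x : ∀ {w} → N w → w ≤ₖ x → ∀ {p} → NonSingleton (proj₁ w) p →
              Σ (LargestThrough X p) λ L → w ≤ₖ top L
    below-x {w} nw w≤x = below-⋁ NX nw (≤mub⇒≤⋁ NX w x mubX w≤x)

    maximal⇒maxBelow : ∀ {v} → v ∈ X → IsMaximalIn X v → MaxBelow N x v
    maximal⇒maxBelow {v} v∈X v-max = All.lookup NX v∈X , All.lookup (proj₁ mubX) v∈X , v-maxBelow
      where
      v-maxBelow : ∀ b → N b → b ≤ₖ x → v ≤ₖ b → b ≤ₖ v
      v-maxBelow b nb b≤x v≤b with nonTrivial nb
      ... | p , nsp with below-x nb b≤x nsp
      ... | L , b≤top = begin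
        b      ≤⟨ b≤top ⟩
        top L  ≤⟨ All.lookup v-max (top∈X L) (begin v ≤⟨ v≤b ⟩ b ≤⟨ b≤top ⟩ top L ∎) ⟩
        v      ∎

    components : List (PiK k m)
    components = deduplicate (_≈ₖ?_ {k} {m}) (filter (isMaximalIn? X) X)

    components-cover : ∀ z → MaxBelow N x z → Any (z ≈ₖ_) components
    components-cover z (nz , z≤x , z-max) with nonTrivial nz
    ... | p , nsp with below-x nz z≤x nsp
    ... | L , z≤top =
      Any.deduplicate⁺ (_≈ₖ?_ {k} {m}) (λ {u} {v} → ≈ₖ-respˡ z {u} {v}) z≈maximal
      where
      top≤z : top L ≤ₖ z
      top≤z = z-max (top L) (All.lookup NX (top∈X L)) (All.lookup (proj₁ mubX) (top∈X L)) z≤top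
      z≈maximal : Any (z ≈ₖ_) (filter (isMaximalIn? X) X)
      z≈maximal = Any.map (λ { refl → z≤top , top≤z })
                          (∈-filter⁺ (isMaximalIn? X) (top∈X L) (top-maximal L))

    components-maxBelow : All (MaxBelow N x) components
    components-maxBelow = All.deduplicate⁺ (_≈ₖ?_ {k} {m}) (All.tabulate λ v∈ →
      let v∈X , v-max = ∈-filter⁻ (isMaximalIn? X) v∈ in maximal⇒maxBelow v∈X v-max)

    components-unique : AllPairs (λ a b → ¬ (a ≈ₖ b)) components
    components-unique = deduplicate-! (≈ₖ-decSetoid {k} {m}) (filter (isMaximalIn? X) X)

    n : ℕ
    n = length components

    z : Fin n → PiK k m
    z = lookup components

    z-maxBelow : ∀ i → MaxBelow N x (z i)
    z-maxBelow i = All.lookup components-maxBelow (∈-lookup i)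

    z-N : ∀ i → N (z i)
    z-N i = proj₁ (z-maxBelow i)

    z≤x : ∀ i → z i ≤ₖ x
    z≤x i = proj₁ (proj₂ (z-maxBelow i))

    z-maximal : ∀ i b → N b → b ≤ₖ x → z i ≤ₖ b → b ≤ₖ z i
    z-maximal i = proj₂ (proj₂ (z-maxBelow i))

    comparable⇒≡ : ∀ i j → z i ≤ₖ z j → i ≡ j
    comparable⇒≡ i j zi≤zj =
      lookup-injective (DecSetoid.setoid (≈ₖ-decSetoid {k} {m})) components-unique i j
        (zi≤zj , z-maximal i (z j) (z-N j) (z≤x j) zi≤zj)

    shared-point⇒≡ : ∀ i j {p} → NonSingleton (proj₁ (z i)) p → NonSingleton (proj₁ (z j)) p →
                     i ≡ j
    shared-point⇒≡ i j nsi nsj with laminar (z-N i) (z-N j) nsi nsj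
    ... | inj₁ zi≤zj = comparable⇒≡ i j zi≤zj
    ... | inj₂ zj≤zi = sym (comparable⇒≡ j i zj≤zi)

    N-below-x⇒below-z : ∀ {w} → N w → w ≤ₖ x → ∃ λ i → w ≤ₖ z i
    N-below-x⇒below-z {w} nw w≤x with nonTrivial nw
    ... | p , nsp with below-x nw w≤x nsp
    ... | L , w≤top = i , (begin w ≤⟨ w≤top ⟩ top L ≤⟨ proj₁ (Any.lookup-index top≈) ⟩ z i ∎)
      where
      top≈ : Any (top L ≈ₖ_) components
      top≈ = components-cover (top L) (maximal⇒maxBelow (top∈X L) (top-maximal L))
      i : Fin n
      i = Any.index top≈

    Pieces : Set
    Pieces = Product Σ𝒩 components

    module _ (t : Pieces) (i : Fin n) where

      piece : PiK k m
      piece = proj₁ (t i)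

      pieceGens : List (PiK k m)
      pieceGens = proj₁ (proj₁ (proj₂ (t i)))

      pieceGens-N : All N pieceGens
      pieceGens-N = proj₁ (proj₂ (proj₁ (proj₂ (t i))))

      pieceGens-≤ : UpperBound pieceGens piece
      pieceGens-≤ = proj₁ (proj₂ (proj₂ (proj₁ (proj₂ (t i)))))

      piece≤⋁ : piece ≤ₖ ⋁ pieceGens pieceGens-N
      piece≤⋁ = minUpperBound⇒≤⋁ pieceGens-N piece (proj₂ (proj₂ (proj₁ (proj₂ (t i)))))

      piece≤z : piece ≤ₖ z i
      piece≤z = proj₂ (proj₂ (t i))

      pieceGen≤z : ∀ {w} → w ∈ pieceGens → w ≤ₖ z i
      pieceGen≤z {w} w∈ = begin w ≤⟨ All.lookup pieceGens-≤ w∈ ⟩ piece ≤⟨ piece≤z ⟩ z i ∎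

    φGens : Pieces → List (PiK k m)
    φGens t = concat (tabulate (pieceGens t))

    All-φGens : ∀ {P : PiK k m → Set} t → (∀ i → All P (pieceGens t i)) → All P (φGens t)
    All-φGens t all = All.concat⁺ (All.tabulate⁺ all)

    ∈-φGens : ∀ t i {w} → w ∈ pieceGens t i → w ∈ φGens t
    ∈-φGens t i w∈ = Any.concat⁺ (Any.tabulate⁺ i w∈)

    φGens-N : ∀ t → All N (φGens t)
    φGens-N t = All-φGens t (pieceGens-N t)

    ⋁φ : Pieces → PiK k m
    ⋁φ t = ⋁ (φGens t) (φGens-N t)

    piece≤⋁φ : ∀ t i → piece t i ≤ₖ ⋁φ t
    piece≤⋁φ t i = begin
      piece t i                             ≤⟨ piece≤⋁ t i ⟩
      ⋁ (pieceGens t i) (pieceGens-N t i)   ≤⟨ ⋁-mono (pieceGens-N t i) (φGens-N t) (∈-φGens t i) ⟩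
      ⋁φ t                                  ∎

    φ : Pieces → Interval Σ𝒩 x
    φ t = ⋁φ t , ⋁-Σ𝒩 (φGens-N t) , ⋁-least (φGens-N t) x (All-φGens t λ i →
            upperBound-≤ (piece t i) x (pieceGens-≤ t i)
              (begin piece t i ≤⟨ piece≤z t i ⟩ z i ≤⟨ z≤x i ⟩ x ∎))

    below? : ∀ i → U.Decidable (_≤ₖ z i)
    below? i w = w ≤ₖ? z i

    ψ : Interval Σ𝒩 x → Pieces
    ψ (_ , (A , NA , _) , _) i =
      ⋁ (filter (below? i) A) NAᵢ , ⋁-Σ𝒩 NAᵢ , ⋁-least NAᵢ (z i) (All.all-filter (below? i) A)
      where
      NAᵢ : All N (filter (below? i) A)
      NAᵢ = All.filter⁺ (below? i) NA

    N-below⇒below-ψ : ∀ b {w} → N w → w ≤ₖ proj₁ b → ∀ i → w ≤ₖ z i → w ≤ₖ piece (ψ b) i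
    N-below⇒below-ψ (b , (B , NB , mubB) , b≤x) {w} nw w≤b i w≤zi with nonTrivial nw
    ... | p , nsp with below-⋁ NB nw (≤mub⇒≤⋁ NB w b mubB w≤b) nsp
    ... | L , w≤v = begin
      w      ≤⟨ w≤v ⟩
      top L  ≤⟨ ⋁-upper (All.filter⁺ (below? i) NB) (∈-filter⁺ (below? i) (top∈X L) v≤zi) ⟩
      piece (ψ (b , (B , NB , mubB) , b≤x)) i ∎
      where
      nv : N (top L)
      nv = All.lookup NB (top∈X L)
      v≤zi : top L ≤ₖ z i
      v≤zi with laminar nv (z-N i) (top-ns L) (nonSingleton-mono (proj₁ w) (proj₁ (z i)) w≤zi nsp)
      ... | inj₁ v≤zi = v≤zi
      ... | inj₂ zi≤v = z-maximal i (top L) nv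
              (begin top L ≤⟨ All.lookup (proj₁ mubB) (top∈X L) ⟩ b ≤⟨ b≤x ⟩ x ∎) zi≤v

    φ-mono : ∀ s t → leP Σ𝒩 components s t → leI Σ𝒩 x (φ s) (φ t)
    φ-mono s t s≤t = ⋁-least (φGens-N s) (⋁φ t) (All-φGens s λ i →
      upperBound-≤ (piece s i) (⋁φ t) (pieceGens-≤ s i)
        (begin piece s i ≤⟨ s≤t i ⟩ piece t i ≤⟨ piece≤⋁φ t i ⟩ ⋁φ t ∎))

    ψ-mono : ∀ a b → leI Σ𝒩 x a b → leP Σ𝒩 components (ψ a) (ψ b)
    ψ-mono (a′ , (A , NA , mubA) , _) b a≤b i =
      ⋁-least (All.filter⁺ (below? i) NA) (piece (ψ b) i)
        (All-filter⁺ (below? i) (All.tabulate λ {w} w∈A →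
          N-below⇒below-ψ b (All.lookup NA w∈A)
            (begin w ≤⟨ All.lookup (proj₁ mubA) w∈A ⟩ a′ ≤⟨ a≤b ⟩ proj₁ b ∎) i))

    ψφ≈ : ∀ t → eqP Σ𝒩 components (ψ (φ t)) t
    ψφ≈ t i = ψφ≤ , ≤ψφ
      where
      NAᵢ : All N (filter (below? i) (φGens t))
      NAᵢ = All.filter⁺ (below? i) (φGens-N t)

      fromPiece : ∀ j {w} → w ∈ pieceGens t j → w ≤ₖ z i → w ≤ₖ piece t i
      fromPiece j {w} w∈ w≤zi with nonTrivial (All.lookup (pieceGens-N t j) w∈)
      ... | p , nsp with shared-point⇒≡ i j (nonSingleton-mono (proj₁ w) (proj₁ (z i)) w≤zi nsp)
                           (nonSingleton-mono (proj₁ w) (proj₁ (z j)) (pieceGen≤z t j w∈) nsp)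
      ... | refl = All.lookup (pieceGens-≤ t i) w∈

      ψφ≤ : piece (ψ (φ t)) i ≤ₖ piece t i
      ψφ≤ = ⋁-least NAᵢ (piece t i)
              (All-filter⁺ (below? i) (All-φGens t λ j → All.tabulate (fromPiece j)))

      ≤ψφ : piece t i ≤ₖ piece (ψ (φ t)) i
      ≤ψφ = begin
        piece t i                             ≤⟨ piece≤⋁ t i ⟩
        ⋁ (pieceGens t i) (pieceGens-N t i)   ≤⟨ ⋁-mono (pieceGens-N t i) NAᵢ pieceGens⊆ ⟩
        piece (ψ (φ t)) i                     ∎
        where
        pieceGens⊆ : ∀ {w} → w ∈ pieceGens t i → w ∈ filter (below? i) (φGens t)
        pieceGens⊆ w∈ = ∈-filter⁺ (below? i) (∈-φGens t i w∈) (pieceGen≤z t i w∈)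

    φψ≈ : ∀ a → eqI Σ𝒩 x (φ (ψ a)) a
    φψ≈ a@(a′ , (A , NA , mubA) , a≤x) =
      ⋁-least (φGens-N (ψ a)) a′ (All-φGens (ψ a) λ i → All.filter⁺ (below? i) (proj₁ mubA)) ,
      (begin
        a′         ≤⟨ minUpperBound⇒≤⋁ NA a′ mubA ⟩
        ⋁ A NA     ≤⟨ ⋁-least NA (⋁φ (ψ a)) (All.tabulate generator≤) ⟩
        ⋁φ (ψ a)   ∎)
      where
      generator≤ : ∀ {w} → w ∈ A → w ≤ₖ ⋁φ (ψ a)
      generator≤ {w} w∈A with N-below-x⇒below-z (All.lookup NA w∈A)
                                (begin w ≤⟨ All.lookup (proj₁ mubA) w∈A ⟩ a′ ≤⟨ a≤x ⟩ x ∎)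
      ... | i , w≤zi = begin
        w                ≤⟨ ⋁-upper (All.filter⁺ (below? i) NA) (∈-filter⁺ (below? i) w∈A w≤zi) ⟩
        piece (ψ a) i    ≤⟨ piece≤⋁φ (ψ a) i ⟩
        ⋁φ (ψ a)         ∎

    φ-basis : ∀ t i → piece t i ≈ₖ z i → (∀ j → ¬ (j ≡ i) → IsBot (proj₁ (piece t j))) →
              ⋁φ t ≈ₖ z i
    φ-basis t i (_ , zi≤ti) bot =
      ⋁-least (φGens-N t) (z i) (All-φGens t λ j → All.tabulate (fromPiece j)) ,
      (begin z i ≤⟨ zi≤ti ⟩ piece t i ≤⟨ piece≤⋁φ t i ⟩ ⋁φ t ∎)
      where
      fromPiece : ∀ j {w} → w ∈ pieceGens t j → w ≤ₖ z i
      fromPiece j {w} w∈ with j FP.≟ i | nonTrivial (All.lookup (pieceGens-N t j) w∈)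
      ... | yes refl | _ = pieceGen≤z t i w∈
      ... | no j≢i   | p , q , q≢p , rpq =
        ⊥-elim (q≢p (sym (bot j j≢i p q (All.lookup (pieceGens-≤ t j) w∈ p q rpq))))

    components-iso : ∃ (IsBuildingIso Σ𝒩 components x)
    components-iso = φ , ψ , φ-mono , ψ-mono , ψφ≈ , φψ≈ , φ-basis

  N-isBuildingSet : IsBuildingSet Σ𝒩 N
  N-isBuildingSet = generator-in-Σ𝒩 , decomposition
    where
    generator-in-Σ𝒩 : ∀ b → N b → Σ𝒩 b × ¬ IsBot (proj₁ b)
    generator-in-Σ𝒩 b nb = (b ∷ [] , nb ∷ [] , ≤ₖ-refl b ∷ [] , λ _ ub _ → All.head ub) , notBot
      where
      notBot : ¬ IsBot (proj₁ b)
      notBot isBot with nonTrivial nb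
      ... | p , q , q≢p , r = q≢p (sym (isBot p q r))
    decomposition : ∀ x → Σ𝒩 x → ¬ IsBot (proj₁ x) →
                    ∃ λ (Z : List (PiK k m)) →
                      (∀ z → MaxBelow N x z → Any (z ≈ₖ_) Z) ×
                      All (MaxBelow N x) Z ×
                      AllPairs (λ a b → ¬ (a ≈ₖ b)) Z ×
                      ∃ (IsBuildingIso Σ𝒩 Z x)
    decomposition x (X , NX , mubX) _ =
      components , components-cover , components-maxBelow , components-unique , components-iso
      where open Components x NX mubX

mainTheorem6 : (k n : ℕ) → 1 ≤ k → 1 ≤ n →
    (N : PiK k ((n ∸ 1) * k + 1) → Set) → InNFamily k ((n ∸ 1) * k + 1) N →
    (∀ (X : List (PiK k ((n ∸ 1) * k + 1))) → All N X → ∃ (IsUniqueJoin X)) ×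
    IsLatticeSub (InSigma N) ×
    IsBuildingSet (InSigma N) N
-- The bounds on k and n, and the particular value of m, play no role.
mainTheorem6 k n _ _ N 𝒩 = (λ X NX → ⋁ X NX , ⋁-isUniqueJoin NX) , Σ𝒩-isLattice , N-isBuildingSet
  where open LaminarFamily (𝒩-isLaminarFamily 𝒩)
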